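{- Let $1\le\delta<\Delta$ be integers with $\delta\Delta$ odd, $\tilde h:\mathbb{Z}^+\to\mathbb{R}^+$ a positive non-increasing function and $\mathcal{J}(G)=\sum_{u\in V(G)}\tilde h(d_u)$. If $G\in\mathcal{L}_{\delta,\Delta}$, then $G$ is minimal for $\mathcal{J}$ on $\mathfrak{G}^{\Delta+3}_{\delta,\Delta}$. Moreover, if $\tilde h(\Delta-1)>\tilde h(\Delta)$, then a graph $G\in\mathfrak{G}^{\Delta+3}_{\delta,\Delta}$ is minimal for $\mathcal{J}$ on $\mathfrak{G}^{\Delta+3}_{\delta,\Delta}$ if and only if $G\in\mathcal{L}_{\delta,\Delta}$.
   Context: All graphs are finite and simple; $d_u$ is the degree of $u$. $\mathfrak{G}^n_{\delta,\Delta}$ is the family of graphs with $n$ vertices, minimum degree $\delta$ and maximum degree $\Delta$. $\mathcal{L}_{\delta,\Delta}$ is the family of graphs having exactly $\Delta+3$ vertices, namely a unique vertex of degree $\delta$ and $\Delta+2$ vertices of degree $\Delta$. A graph $G$ in a family $\mathcal{F}$ is minimal for $\mathcal{J}$ on $\mathcal{F}$ if $\mathcal{J}(G)\le\mathcal{J}(\Gamma)$ for all $\Gamma\in\mathcal{F}$. -}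

module Defs where

open import Level using (Level; _⊔_) renaming (suc to lsuc)
open import Data.Nat using (ℕ; zero; suc; _+_; _≤_)
open import Data.Fin using (Fin; zero; suc)
open import Data.Bool using (Bool; true; false; if_then_else_)
open import Data.Product using (Σ; _×_; ∃)
open import Relation.Binary.PropositionalEquality using (_≡_; _≢_)
open import Relation.Binary.Core using (Rel)
open import Relation.Binary.Structures using (IsTotalOrder)
open import Relation.Nullary using (¬_)
open import Algebra.Bundles using (AbelianGroup)

-- Agda's stdlib has no reals; we quantify over every
-- totally ordered abelian group (ℝ with + and ≤ is one instance), so the
-- statement below is a generalisation of the real-valued one.

record OrderedAbelianGroup (c ℓ₁ ℓ₂ : Level) : Set (lsuc (c ⊔ ℓ₁ ⊔ ℓ₂)) where
  field
    abelianGroup : AbelianGroup c ℓ₁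
  open AbelianGroup abelianGroup public
  field
    _≤ᵍ_         : Rel Carrier ℓ₂
    isTotalOrder : IsTotalOrder _≈_ _≤ᵍ_
    ≤ᵍ-compat    : ∀ {x y} z → x ≤ᵍ y → (x ∙ z) ≤ᵍ (y ∙ z)

  _<ᵍ_ : Rel Carrier (ℓ₁ ⊔ ℓ₂)
  x <ᵍ y = (x ≤ᵍ y) × (¬ (x ≈ y))

record Graph (n : ℕ) : Set where
  field
    adj    : Fin n → Fin n → Bool
    sym    : ∀ i j → adj i j ≡ adj j i
    irrefl : ∀ i → adj i i ≡ false
open Graph public

countFin : ∀ {n} → (Fin n → Bool) → ℕ
countFin {zero}  p = 0
countFin {suc n} p = (if p zero then 1 else 0) + countFin (λ j → p (suc j))

deg : ∀ {n} → Graph n → Fin n → ℕ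
deg G u = countFin (adj G u)

InFamily : ∀ {n} → ℕ → ℕ → Graph n → Set
InFamily δ Δ G =
  (∃ λ u → deg G u ≡ δ) × (∀ u → δ ≤ deg G u) ×
  (∃ λ u → deg G u ≡ Δ) × (∀ u → deg G u ≤ Δ)

InL : (δ Δ : ℕ) → Graph (Δ + 3) → Set
InL δ Δ G =
  Σ (Fin (Δ + 3)) λ u → (deg G u ≡ δ) ×
    (∀ v → deg G v ≡ δ → v ≡ u) × (∀ v → v ≢ u → deg G v ≡ Δ)

module _ {c ℓ₁ ℓ₂} (A : OrderedAbelianGroup c ℓ₁ ℓ₂) where
  open OrderedAbelianGroup A

  sumFin : ∀ {n} → (Fin n → Carrier) → Carrier
  sumFin {zero}  f = ε
  sumFin {suc n} f = f zero ∙ sumFin (λ j → f (suc j))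

  𝒥 : (ℕ → Carrier) → ∀ {n} → Graph n → Carrier
  𝒥 h G = sumFin (λ u → h (deg G u))

  Minimal : (ℕ → Carrier) → ∀ {n} → ℕ → ℕ → Graph n → Set ℓ₂
  Minimal h {n} δ Δ G =
    InFamily δ Δ G × (∀ (Γ : Graph n) → InFamily δ Δ Γ → 𝒥 h G ≤ᵍ 𝒥 h Γ)

-- Every vertex of a graph in the family has degree in [δ, Δ] and some vertex has degree δ, so,
-- h̃ being non-increasing, 𝒥 is at least h̃(δ) + (n − 1) h̃(Δ); graphs of 𝓛_{δ,Δ} attain this
-- bound. Conversely a second vertex of degree < Δ costs at least h̃(Δ − 1) − h̃(Δ) > 0, so once
-- 𝓛_{δ,Δ} is known to be non-empty, only its members are minimal. For δ and Δ = δ + 2r odd,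
-- a member is the complement of a cone over a linear forest: a path on δ + 2 vertices and r
-- disjoint edges, with the apex joined to the 2r + 2 leaves.
module Submission where

open import Defs hiding (sym)
open import Level using (Level)
open import Data.Nat using (ℕ; zero; suc; _+_; _*_; _∸_; _≤_; _<_; s≤s; pred)
import Data.Nat.Properties as ℕ
open import Data.Nat.Divisibility
  using (_∣_; divides; ∣-refl; _∣0; ∣m∣n⇒∣m+n; ∣m+n∣m⇒∣n; ∣m⇒∣m*n; ∣n⇒∣m*n)
open import Data.Nat.Tactic.RingSolver using (solve-∀)
open import Data.Fin using (Fin; zero; suc; punchIn; punchOut; _≟_)
open import Data.Fin.Properties using (punchInᵢ≢i; punchIn-punchOut)
open import Data.Bool using (Bool; true; false; if_then_else_; not; _∧_)
open import Data.Bool.Properties using (∧-zeroʳ; ∧-identityʳ)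
open import Data.Product using (_×_; _,_; proj₁; proj₂; Σ; ∃)
open import Data.Sum using (inj₁; inj₂)
open import Function using (_∘_)
open import Function.Bundles using (_⇔_; mk⇔)
open import Relation.Nullary using (¬_; yes; no; does; contradiction)
open import Relation.Nullary.Decidable using (dec-true; dec-false)
open import Relation.Binary.PropositionalEquality
  using (_≡_; _≢_; refl; sym; trans; cong; cong₂; subst; module ≡-Reasoning)
open import Relation.Binary.Bundles using (Poset)
open import Relation.Binary.Structures using (IsTotalOrder)
import Relation.Binary.Reasoning.PartialOrder as PosetReasoning
import Relation.Binary.Properties.Poset as PosetProperties
import Algebra.Properties.Group as GroupProperties
import Algebra.Properties.CommutativeSemigroup as CommutativeSemigroupProperties

𝟙[_] : Bool → ℕ
𝟙[ b ] = if b then 1 else 0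

countFin-cong : ∀ {n} {p q : Fin n → Bool} → (∀ i → p i ≡ q i) → countFin p ≡ countFin q
countFin-cong {zero}  p≗q = refl
countFin-cong {suc n} p≗q =
  cong₂ (λ b k → 𝟙[ b ] + k) (p≗q zero) (countFin-cong (p≗q ∘ suc))

countFin-false : ∀ n → countFin {n} (λ _ → false) ≡ 0
countFin-false zero    = refl
countFin-false (suc n) = countFin-false n

countFin-not : ∀ {n} (p : Fin n → Bool) → countFin (not ∘ p) + countFin p ≡ n
countFin-not {zero}  p = refl
countFin-not {suc n} p with p zero
... | true  = trans (ℕ.+-suc _ _) (cong suc (countFin-not (p ∘ suc)))
... | false = cong suc (countFin-not (p ∘ suc))

countFin-punchIn : ∀ {n} (p : Fin (suc n) → Bool) i →
                   countFin p ≡ 𝟙[ p i ] + countFin (p ∘ punchIn i)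
countFin-punchIn         p zero    = refl
countFin-punchIn {suc n} p (suc i) =
  trans (cong (𝟙[ p zero ] +_) (countFin-punchIn (p ∘ suc) i))
        (x∙yz≈y∙xz 𝟙[ p zero ] 𝟙[ p (suc i) ] _)
  where open CommutativeSemigroupProperties ℕ.+-commutativeSemigroup using (x∙yz≈y∙xz)

addVertex : ∀ {n} → Graph n → (Fin n → Bool) → Graph (suc n)
addVertex {n} G S = record { adj = a ; sym = a-sym ; irrefl = a-irrefl }
  where
  a : Fin (suc n) → Fin (suc n) → Bool
  a zero    zero    = false
  a zero    (suc j) = S j
  a (suc i) zero    = S i
  a (suc i) (suc j) = adj G i j
  a-sym : ∀ i j → a i j ≡ a j i
  a-sym zero    zero    = refl
  a-sym zero    (suc j) = refl
  a-sym (suc i) zero    = refl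
  a-sym (suc i) (suc j) = Graph.sym G i j
  a-irrefl : ∀ i → a i i ≡ false
  a-irrefl zero    = refl
  a-irrefl (suc i) = irrefl G i

≟-sym : ∀ {n} (i j : Fin n) → does (i ≟ j) ≡ does (j ≟ i)
≟-sym i j with i ≟ j
... | yes refl = sym (dec-true (i ≟ i) refl)
... | no  i≢j  = sym (dec-false (j ≟ i) (i≢j ∘ sym))

complement : ∀ {n} → Graph n → Graph n
complement G = record
  { adj    = λ i j → not (adj G i j) ∧ not (does (i ≟ j))
  ; sym    = λ i j → cong₂-∧ (Graph.sym G i j) (≟-sym i j)
  ; irrefl = λ i → trans (cong (λ b → not (adj G i i) ∧ not b) (dec-true (i ≟ i) refl))
                         (∧-zeroʳ _)
  }
  where
  cong₂-∧ : ∀ {a b c d} → a ≡ b → c ≡ d → not a ∧ not c ≡ not b ∧ not d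
  cong₂-∧ refl refl = refl

deg-complement : ∀ {n} (G : Graph (suc n)) i → deg (complement G) i + deg G i ≡ n
deg-complement {n} G i = begin
  deg (complement G) i + deg G i
    ≡⟨ cong₂ _+_ (countFin-punchIn (adjᶜ i) i) (countFin-punchIn (adj G i) i) ⟩
  𝟙[ adjᶜ i i ] + countFin (adjᶜ i ∘ punchIn i)
    + (𝟙[ adj G i i ] + countFin (adj G i ∘ punchIn i))
    ≡⟨ cong₂ (λ a b → 𝟙[ a ] + countFin (adjᶜ i ∘ punchIn i)
                        + (𝟙[ b ] + countFin (adj G i ∘ punchIn i)))
             (irrefl (complement G) i) (irrefl G i) ⟩
  countFin (adjᶜ i ∘ punchIn i) + countFin (adj G i ∘ punchIn i)
    ≡⟨ cong (_+ countFin (adj G i ∘ punchIn i)) (countFin-cong off-diagonal) ⟩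
  countFin (not ∘ adj G i ∘ punchIn i) + countFin (adj G i ∘ punchIn i)
    ≡⟨ countFin-not (adj G i ∘ punchIn i) ⟩
  n ∎
  where
  open ≡-Reasoning
  adjᶜ : Fin (suc n) → Fin (suc n) → Bool
  adjᶜ = adj (complement G)
  off-diagonal : ∀ j → adjᶜ i (punchIn i j) ≡ not (adj G i (punchIn i j))
  off-diagonal j = trans (cong (λ b → not (adj G i (punchIn i j)) ∧ not b)
                               (dec-false (i ≟ punchIn i j) (punchInᵢ≢i i j ∘ sym)))
                         (∧-identityʳ (not (adj G i (punchIn i j))))

record EndMarked (n : ℕ) : Set where
  field
    graph   : Graph n
    isEnd   : Fin n → Bool
    deg-end : ∀ i → 𝟙[ isEnd i ] + deg graph i ≡ 2
open EndMarked

isZero : ∀ {n} → Fin n → Bool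
isZero zero    = true
isZero (suc _) = false

countFin-isZero : ∀ n → countFin (isZero {suc n}) ≡ 1
countFin-isZero n = cong suc (countFin-false n)

emptyEndMarked : EndMarked 0
emptyEndMarked = record
  { graph = record { adj = λ () ; sym = λ () ; irrefl = λ () }
  ; isEnd = λ ()
  ; deg-end = λ ()
  }

addEdge : ∀ {n} → EndMarked n → EndMarked (suc (suc n))
addEdge {n} F = record
  { graph   = G
  ; isEnd   = ends
  ; deg-end = ends-deg
  }
  where
  G : Graph (suc (suc n))
  G = addVertex (addVertex (graph F) (λ _ → false)) isZero
  ends : Fin (suc (suc n)) → Bool
  ends zero          = true
  ends (suc zero)    = true
  ends (suc (suc i)) = isEnd F i
  ends-deg : ∀ i → 𝟙[ ends i ] + deg G i ≡ 2
  ends-deg zero          = cong suc (countFin-isZero n)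
  ends-deg (suc zero)    = cong (2 +_) (countFin-false n)
  ends-deg (suc (suc i)) = deg-end F i

extendAtZero : ∀ {n} (F : EndMarked (suc n)) → isEnd F zero ≡ true → EndMarked (suc (suc n))
extendAtZero {n} F end₀ = record
  { graph   = G
  ; isEnd   = ends
  ; deg-end = ends-deg
  }
  where
  G : Graph (suc (suc n))
  G = addVertex (graph F) isZero
  ends : Fin (suc (suc n)) → Bool
  ends zero          = true
  ends (suc zero)    = false
  ends (suc (suc i)) = isEnd F (suc i)
  ends-deg : ∀ i → 𝟙[ ends i ] + deg G i ≡ 2
  ends-deg zero          = cong suc (countFin-isZero n)
  ends-deg (suc zero)    = subst (λ b → 𝟙[ b ] + deg (graph F) zero ≡ 2) end₀ (deg-end F zero)
  ends-deg (suc (suc i)) = deg-end F (suc i)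

countFin-extendAtZero : ∀ {n} (F : EndMarked (suc n)) end₀ →
                        countFin (isEnd (extendAtZero F end₀)) ≡ countFin (isEnd F)
countFin-extendAtZero F end₀ rewrite end₀ = refl

path : ∀ m → EndMarked (suc (suc m))
path-end₀ : ∀ m → isEnd (path m) zero ≡ true

path zero    = addEdge emptyEndMarked
path (suc m) = extendAtZero (path m) (path-end₀ m)

path-end₀ zero    = refl
path-end₀ (suc m) = refl

countFin-path : ∀ m → countFin (isEnd (path m)) ≡ 2
countFin-path zero    = refl
countFin-path (suc m) = trans (countFin-extendAtZero (path m) (path-end₀ m)) (countFin-path m)

addEdges : ∀ r {n} → EndMarked n → EndMarked (r * 2 + n)
addEdges zero    F = F
addEdges (suc r) F = addEdge (addEdges r F)

countFin-addEdges : ∀ r {n} (F : EndMarked n) →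
                    countFin (isEnd (addEdges r F)) ≡ r * 2 + countFin (isEnd F)
countFin-addEdges zero    F = refl
countFin-addEdges (suc r) F = cong (2 +_) (countFin-addEdges r F)

cone : ∀ {n} → EndMarked n → Graph (suc n)
cone F = addVertex (graph F) (isEnd F)

lowHub : ∀ δ r → Graph (suc (r * 2 + (2 + δ)))
lowHub δ r = complement (cone (addEdges r (path δ)))

deg-lowHub-zero : ∀ δ r → deg (lowHub δ r) zero ≡ δ
deg-lowHub-zero δ r = ℕ.+-cancelʳ-≡ (r * 2 + 2) _ δ (begin
  deg (lowHub δ r) zero + (r * 2 + 2)
    ≡⟨ cong (deg (lowHub δ r) zero +_) (sym apex-deg) ⟩
  deg (lowHub δ r) zero + deg (cone F) zero
    ≡⟨ deg-complement (cone F) zero ⟩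
  r * 2 + (2 + δ)
    ≡⟨ shuffle δ r ⟩
  δ + (r * 2 + 2) ∎)
  where
  open ≡-Reasoning
  F : EndMarked (r * 2 + (2 + δ))
  F = addEdges r (path δ)
  apex-deg : deg (cone F) zero ≡ r * 2 + 2
  apex-deg = trans (countFin-addEdges r (path δ)) (cong (r * 2 +_) (countFin-path δ))
  shuffle : ∀ δ r → r * 2 + (2 + δ) ≡ δ + (r * 2 + 2)
  shuffle = solve-∀

deg-lowHub-suc : ∀ δ r i → deg (lowHub δ r) (suc i) ≡ δ + r * 2
deg-lowHub-suc δ r i = ℕ.+-cancelʳ-≡ 2 _ (δ + r * 2) (begin
  deg (lowHub δ r) (suc i) + 2
    ≡⟨ cong (deg (lowHub δ r) (suc i) +_) (sym rim-deg) ⟩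
  deg (lowHub δ r) (suc i) + deg (cone F) (suc i)
    ≡⟨ deg-complement (cone F) (suc i) ⟩
  r * 2 + (2 + δ)
    ≡⟨ shuffle δ r ⟩
  δ + r * 2 + 2 ∎)
  where
  open ≡-Reasoning
  F : EndMarked (r * 2 + (2 + δ))
  F = addEdges r (path δ)
  rim-deg : deg (cone F) (suc i) ≡ 2
  rim-deg = deg-end F i
  shuffle : ∀ δ r → r * 2 + (2 + δ) ≡ δ + r * 2 + 2
  shuffle = solve-∀

𝓛Shaped : ∀ {n} → ℕ → ℕ → Graph n → Set
𝓛Shaped {n} δ Δ G =
  Σ (Fin n) λ u → (deg G u ≡ δ) ×
    (∀ v → deg G v ≡ δ → v ≡ u) × (∀ v → v ≢ u → deg G v ≡ Δ)

𝓛Shaped-lowHub : ∀ δ r → δ ≢ δ + r * 2 → 𝓛Shaped δ (δ + r * 2) (lowHub δ r)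
𝓛Shaped-lowHub δ r δ≢Δ = zero , deg-lowHub-zero δ r , unique , others
  where
  others : ∀ v → v ≢ zero → deg (lowHub δ r) v ≡ δ + r * 2
  others zero    0≢0 = contradiction refl 0≢0
  others (suc i) _   = deg-lowHub-suc δ r i
  unique : ∀ v → deg (lowHub δ r) v ≡ δ → v ≡ zero
  unique zero    _  = refl
  unique (suc i) eq = contradiction (trans (sym eq) (deg-lowHub-suc δ r i)) δ≢Δ

odd⇒2∣suc : ∀ n → ¬ 2 ∣ n → 2 ∣ suc n
odd⇒2∣suc zero          ¬2∣0   = contradiction (2 ∣0) ¬2∣0
odd⇒2∣suc (suc zero)    _      = ∣-refl
odd⇒2∣suc (suc (suc n)) ¬2∣n+2 =
  ∣m∣n⇒∣m+n ∣-refl (odd⇒2∣suc n (¬2∣n+2 ∘ ∣m∣n⇒∣m+n ∣-refl))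

odd+odd⇒even : ∀ m d → ¬ 2 ∣ m → ¬ 2 ∣ m + d → 2 ∣ d
odd+odd⇒even m d m-odd m+d-odd = ∣m+n∣m⇒∣n (odd⇒2∣suc (m + d) m+d-odd) (odd⇒2∣suc m m-odd)

𝓛Shaped-exists : ∀ {δ Δ} → δ < Δ → ¬ 2 ∣ δ → ¬ 2 ∣ Δ → Σ (Graph (Δ + 3)) (𝓛Shaped δ Δ)
𝓛Shaped-exists {δ} δ<Δ δ-odd Δ-odd with ℕ.m≤n⇒∃[o]m+o≡n (ℕ.<⇒≤ δ<Δ)
... | d , refl with odd+odd⇒even δ d δ-odd Δ-odd
... | divides r refl =
  subst (λ n → Σ (Graph n) (𝓛Shaped δ (δ + r * 2))) (vertices δ r)
        (lowHub δ r , 𝓛Shaped-lowHub δ r (ℕ.<⇒≢ δ<Δ))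
  where
  vertices : ∀ δ r → suc (r * 2 + (2 + δ)) ≡ δ + r * 2 + 3
  vertices = solve-∀

∃≢ : ∀ {n} → 2 ≤ n → (u : Fin n) → ∃ λ v → v ≢ u
∃≢ (s≤s (s≤s _)) zero    = suc zero , λ ()
∃≢ (s≤s (s≤s _)) (suc _) = zero , λ ()

𝓛Shaped⇒InFamily : ∀ {n δ Δ} (G : Graph n) → 2 ≤ n → δ ≤ Δ → 𝓛Shaped δ Δ G → InFamily δ Δ G
𝓛Shaped⇒InFamily {n} {δ} {Δ} G 2≤n δ≤Δ (u , du , _ , others) =
  (u , du) , lower , (v , others v v≢u) , upper
  where
  v : Fin n
  v = proj₁ (∃≢ 2≤n u)
  v≢u : v ≢ u
  v≢u = proj₂ (∃≢ 2≤n u)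
  lower : ∀ w → δ ≤ deg G w
  lower w with w ≟ u
  ... | yes refl = ℕ.≤-reflexive (sym du)
  ... | no  w≢u  = subst (δ ≤_) (sym (others w w≢u)) δ≤Δ
  upper : ∀ w → deg G w ≤ Δ
  upper w with w ≟ u
  ... | yes refl = subst (_≤ Δ) (sym du) δ≤Δ
  ... | no  w≢u  = ℕ.≤-reflexive (others w w≢u)

module OrderedSums {c ℓ₁ ℓ₂} (A : OrderedAbelianGroup c ℓ₁ ℓ₂) where
  open OrderedAbelianGroup A
    renaming (refl to ≈-refl; trans to ≈-trans)

  poset : Poset c ℓ₁ ℓ₂
  poset = record { isPartialOrder = IsTotalOrder.isPartialOrder isTotalOrder }

  open Poset poset public using () renaming (reflexive to ≤-reflexive)
  open PosetProperties poset public using (≤⇒≯)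
  open PosetReasoning poset public
  open GroupProperties group using (∙-cancelʳ)
  open CommutativeSemigroupProperties commutativeSemigroup using (x∙yz≈y∙xz)

  ∙-monoʳ-≤ : ∀ z {x y} → x ≤ᵍ y → (z ∙ x) ≤ᵍ (z ∙ y)
  ∙-monoʳ-≤ z {x} {y} x≤y = begin
    z ∙ x ≈⟨ comm z x ⟩
    x ∙ z ≤⟨ ≤ᵍ-compat z x≤y ⟩
    y ∙ z ≈⟨ comm y z ⟩
    z ∙ y ∎

  ∙-mono-≤ : ∀ {x y u v} → x ≤ᵍ y → u ≤ᵍ v → (x ∙ u) ≤ᵍ (y ∙ v)
  ∙-mono-≤ {x} {y} {u} {v} x≤y u≤v = begin
    x ∙ u ≤⟨ ≤ᵍ-compat u x≤y ⟩
    y ∙ u ≤⟨ ∙-monoʳ-≤ y u≤v ⟩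
    y ∙ v ∎

  ∙-monoˡ-< : ∀ z {x y} → x <ᵍ y → (x ∙ z) <ᵍ (y ∙ z)
  ∙-monoˡ-< z (x≤y , x≉y) = ≤ᵍ-compat z x≤y , x≉y ∘ ∙-cancelʳ z _ _

  ∙-monoʳ-< : ∀ z {x y} → x <ᵍ y → (z ∙ x) <ᵍ (z ∙ y)
  ∙-monoʳ-< z {x} {y} x<y = begin-strict
    z ∙ x ≈⟨ comm z x ⟩
    x ∙ z <⟨ ∙-monoˡ-< z x<y ⟩
    y ∙ z ≈⟨ comm y z ⟩
    z ∙ y ∎

  sumFin-cong : ∀ {n} {f g : Fin n → Carrier} → (∀ i → f i ≈ g i) → sumFin A f ≈ sumFin A g
  sumFin-cong {zero}  f≈g = ≈-refl
  sumFin-cong {suc n} f≈g = ∙-cong (f≈g zero) (sumFin-cong (f≈g ∘ suc))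

  sumFin-mono : ∀ {n} {f g : Fin n → Carrier} → (∀ i → f i ≤ᵍ g i) → sumFin A f ≤ᵍ sumFin A g
  sumFin-mono {zero}  f≤g = ≤-reflexive ≈-refl
  sumFin-mono {suc n} f≤g = ∙-mono-≤ (f≤g zero) (sumFin-mono (f≤g ∘ suc))

  sumFin-mono-< : ∀ {n} {f g : Fin n → Carrier} → (∀ i → f i ≤ᵍ g i) →
                  ∀ i → f i <ᵍ g i → sumFin A f <ᵍ sumFin A g
  sumFin-mono-< {suc n} {f} {g} f≤g zero fi<gi = begin-strict
    f zero ∙ sumFin A (f ∘ suc) <⟨ ∙-monoˡ-< _ fi<gi ⟩
    g zero ∙ sumFin A (f ∘ suc) ≤⟨ ∙-monoʳ-≤ _ (sumFin-mono (f≤g ∘ suc)) ⟩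
    g zero ∙ sumFin A (g ∘ suc) ∎
  sumFin-mono-< {suc n} {f} {g} f≤g (suc i) fi<gi = begin-strict
    f zero ∙ sumFin A (f ∘ suc) ≤⟨ ≤ᵍ-compat _ (f≤g zero) ⟩
    g zero ∙ sumFin A (f ∘ suc) <⟨ ∙-monoʳ-< _ (sumFin-mono-< (f≤g ∘ suc) i fi<gi) ⟩
    g zero ∙ sumFin A (g ∘ suc) ∎

  sumFin-punchIn : ∀ {n} (f : Fin (suc n) → Carrier) i → sumFin A f ≈ f i ∙ sumFin A (f ∘ punchIn i)
  sumFin-punchIn         f zero    = ≈-refl
  sumFin-punchIn {suc n} f (suc i) =
    ≈-trans (∙-congˡ (sumFin-punchIn (f ∘ suc) i)) (x∙yz≈y∙xz (f zero) (f (suc i)) _)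

module Bounds {c ℓ₁ ℓ₂} (A : OrderedAbelianGroup c ℓ₁ ℓ₂)
              (h : ℕ → OrderedAbelianGroup.Carrier A) (δ Δ : ℕ) where
  open OrderedAbelianGroup A using (Carrier; _≈_; _∙_; _≤ᵍ_; _<ᵍ_; ∙-congˡ; ∙-congʳ; reflexive)
    renaming (trans to ≈-trans)
  open OrderedSums A

  𝒥ᴸ : ℕ → Carrier
  𝒥ᴸ n = h δ ∙ sumFin A {pred n} (λ _ → h Δ)

  𝒥-around : ∀ {n} (Γ : Graph (suc n)) u → deg Γ u ≡ δ →
             𝒥 A h Γ ≈ h δ ∙ sumFin A (λ j → h (deg Γ (punchIn u j)))
  𝒥-around Γ u du = ≈-trans (sumFin-punchIn (h ∘ deg Γ) u) (∙-congʳ (reflexive (cong h du)))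

  𝒥-𝓛Shaped : ∀ {n} (G : Graph n) → 𝓛Shaped δ Δ G → 𝒥 A h G ≈ 𝒥ᴸ n
  𝒥-𝓛Shaped {zero}  G (() , _)
  𝒥-𝓛Shaped {suc n} G (u , du , _ , others) =
    ≈-trans (𝒥-around G u du)
            (∙-congˡ (sumFin-cong (λ j → reflexive (cong h (others _ (punchInᵢ≢i u j))))))

  module _ (1≤δ : 1 ≤ δ) (h-antitone : ∀ a b → 1 ≤ a → a ≤ b → h b ≤ᵍ h a) where

    hΔ≤h[deg] : ∀ {n} (Γ : Graph n) → InFamily δ Δ Γ → ∀ w → h Δ ≤ᵍ h (deg Γ w)
    hΔ≤h[deg] Γ (_ , lower , _ , upper) w =
      h-antitone (deg Γ w) Δ (ℕ.≤-trans 1≤δ (lower w)) (upper w)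

    𝒥ᴸ-≤-𝒥 : ∀ {n} (Γ : Graph n) → InFamily δ Δ Γ → 𝒥ᴸ n ≤ᵍ 𝒥 A h Γ
    𝒥ᴸ-≤-𝒥 {zero}  Γ ((() , _) , _)
    𝒥ᴸ-≤-𝒥 {suc n} Γ Γ∈@((u , du) , _) = begin
      𝒥ᴸ (suc n)
        ≤⟨ ∙-monoʳ-≤ (h δ) (sumFin-mono (hΔ≤h[deg] Γ Γ∈ ∘ punchIn u)) ⟩
      h δ ∙ sumFin A (λ j → h (deg Γ (punchIn u j)))
        ≈⟨ 𝒥-around Γ u du ⟨
      𝒥 A h Γ ∎

    𝒥ᴸ-<-𝒥 : h Δ <ᵍ h (Δ ∸ 1) → ∀ {n} (Γ : Graph n) (Γ∈ : InFamily δ Δ Γ) →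
             ∀ v → v ≢ proj₁ (proj₁ Γ∈) → deg Γ v < Δ → 𝒥ᴸ n <ᵍ 𝒥 A h Γ
    𝒥ᴸ-<-𝒥 hΔ<hΔ-1 {suc n} Γ Γ∈@((u , du) , lower , _ , _) v v≢u dv<Δ = begin-strict
      𝒥ᴸ (suc n)
        <⟨ ∙-monoʳ-< (h δ) (sumFin-mono-< (hΔ≤h[deg] Γ Γ∈ ∘ punchIn u) (punchOut u≢v) at-v) ⟩
      h δ ∙ sumFin A (λ j → h (deg Γ (punchIn u j)))
        ≈⟨ 𝒥-around Γ u du ⟨
      𝒥 A h Γ ∎
      where
      u≢v : u ≢ v
      u≢v = v≢u ∘ sym
      dv≤Δ-1 : deg Γ v ≤ Δ ∸ 1
      dv≤Δ-1 = ℕ.∸-monoˡ-≤ 1 dv<Δ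
      hΔ<h[dv] : h Δ <ᵍ h (deg Γ v)
      hΔ<h[dv] = begin-strict
        h Δ         <⟨ hΔ<hΔ-1 ⟩
        h (Δ ∸ 1)   ≤⟨ h-antitone (deg Γ v) (Δ ∸ 1) (ℕ.≤-trans 1≤δ (lower v)) dv≤Δ-1 ⟩
        h (deg Γ v) ∎
      at-v : h Δ <ᵍ h (deg Γ (punchIn u (punchOut u≢v)))
      at-v = subst (λ w → h Δ <ᵍ h (deg Γ w)) (sym (punchIn-punchOut u≢v)) hΔ<h[dv]

    𝒥≤𝒥ᴸ⇒𝓛Shaped : δ < Δ → h Δ <ᵍ h (Δ ∸ 1) → ∀ {n} (Γ : Graph n) → InFamily δ Δ Γ →
                   𝒥 A h Γ ≤ᵍ 𝒥ᴸ n → 𝓛Shaped δ Δ Γ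
    𝒥≤𝒥ᴸ⇒𝓛Shaped δ<Δ hΔ<hΔ-1 Γ Γ∈@((u , du) , _ , _ , upper) 𝒥≤𝒥ᴸ =
      u , du , unique , others
      where
      others : ∀ v → v ≢ u → deg Γ v ≡ Δ
      others v v≢u with ℕ.m≤n⇒m<n∨m≡n (upper v)
      ... | inj₁ dv<Δ = contradiction (𝒥ᴸ-<-𝒥 hΔ<hΔ-1 Γ Γ∈ v v≢u dv<Δ) (≤⇒≯ 𝒥≤𝒥ᴸ)
      ... | inj₂ dv≡Δ = dv≡Δ
      unique : ∀ v → deg Γ v ≡ δ → v ≡ u
      unique v dv with v ≟ u
      ... | yes v≡u = v≡u
      ... | no  v≢u = contradiction (trans (sym dv) (others v v≢u)) (ℕ.<⇒≢ δ<Δ)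

theorem2p15 : ∀ {c ℓ₁ ℓ₂ : Level} (A : OrderedAbelianGroup c ℓ₁ ℓ₂)
    (δ Δ : ℕ) → 1 ≤ δ → δ < Δ → ¬ (2 ∣ δ * Δ) →
    (h : ℕ → OrderedAbelianGroup.Carrier A) →
    (∀ a → 1 ≤ a → OrderedAbelianGroup._<ᵍ_ A (OrderedAbelianGroup.ε A) (h a)) →
    (∀ a b → 1 ≤ a → a ≤ b → OrderedAbelianGroup._≤ᵍ_ A (h b) (h a)) →
    ((G : Graph (Δ + 3)) → InL δ Δ G → Minimal A h δ Δ G)
    × (OrderedAbelianGroup._<ᵍ_ A (h Δ) (h (Δ ∸ 1)) →
    (G : Graph (Δ + 3)) → InFamily δ Δ G → (Minimal A h δ Δ G ⇔ InL δ Δ G))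
theorem2p15 A δ Δ 1≤δ δ<Δ δΔ-odd h _ h-antitone = 𝓛⇒minimal , minimal⇔𝓛
  where
  open OrderedAbelianGroup A using (_<ᵍ_)
  open OrderedSums A using (begin_; step-≈-⟩; step-≤; _∎)
  open Bounds A h δ Δ

  2≤Δ+3 : 2 ≤ Δ + 3
  2≤Δ+3 = ℕ.≤-trans (ℕ.n≤1+n 2) (ℕ.m≤n+m 3 Δ)

  𝓛⇒minimal : (G : Graph (Δ + 3)) → InL δ Δ G → Minimal A h δ Δ G
  𝓛⇒minimal G G∈𝓛 = 𝓛Shaped⇒InFamily G 2≤Δ+3 (ℕ.<⇒≤ δ<Δ) G∈𝓛 , λ Γ Γ∈ → begin
      𝒥 A h G      ≈⟨ 𝒥-𝓛Shaped G G∈𝓛 ⟩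
      𝒥ᴸ (Δ + 3)   ≤⟨ 𝒥ᴸ-≤-𝒥 1≤δ h-antitone Γ Γ∈ ⟩
      𝒥 A h Γ      ∎

  minimal⇔𝓛 : h Δ <ᵍ h (Δ ∸ 1) → (G : Graph (Δ + 3)) → InFamily δ Δ G →
              Minimal A h δ Δ G ⇔ InL δ Δ G
  minimal⇔𝓛 hΔ<hΔ-1 G G∈ = mk⇔ minimal⇒𝓛 (𝓛⇒minimal G)
    where
    L : Σ (Graph (Δ + 3)) (InL δ Δ)
    L = 𝓛Shaped-exists δ<Δ (δΔ-odd ∘ ∣m⇒∣m*n Δ) (δΔ-odd ∘ ∣n⇒∣m*n δ)
    minimal⇒𝓛 : Minimal A h δ Δ G → InL δ Δ G
    minimal⇒𝓛 (_ , G-min) = 𝒥≤𝒥ᴸ⇒𝓛Shaped 1≤δ h-antitone δ<Δ hΔ<hΔ-1 G G∈ (begin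
      𝒥 A h G          ≤⟨ G-min (proj₁ L) (proj₁ (𝓛⇒minimal (proj₁ L) (proj₂ L))) ⟩
      𝒥 A h (proj₁ L)  ≈⟨ 𝒥-𝓛Shaped (proj₁ L) (proj₂ L) ⟩
      𝒥ᴸ (Δ + 3)       ∎)
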